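{- For all integers $n\ge1$, $d$, $t$, we have $s(n,d,t)=s(n,\,n-1-d,\,t+2d-n+1)$. In particular, for all $n\ge1$, $s(2n,n-1,0)=s(2n,n,-1)$.
   Context: For $\pi=\pi_1\cdots\pi_n\in S_n$ and $1\le i\le n-1$, let $q_i^\pi=+1$ if $\pi_i<\pi_{i+1}$ and $q_i^\pi=-1$ if $\pi_i>\pi_{i+1}$ (a descent is a position with $q_i^\pi=-1$). For $0\le k\le n-1$ let $T_k(\pi)=\sum_{i=1}^k q_i^\pi$ (so $T_0(\pi)=0$), and $T(\pi)=\min_{0\le k\le n-1}T_k(\pi)$. $S(n,d,t)$ is the set of $\pi\in S_n$ with exactly $d$ descents and $T(\pi)=t$, and $s(n,d,t)=|S(n,d,t)|$. -}

module Defs where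

open import Data.Nat using (ℕ; zero; suc; _<ᵇ_)
open import Data.Fin using (Fin; toℕ)
open import Data.Fin.Properties using (_≟_)
open import Data.Bool using (Bool; true; false; if_then_else_; _∧_; not)
open import Data.List using (List; []; _∷_; map; concatMap; allFin; filterᵇ; length; scanl; foldr)
open import Data.Bool.ListAction using (any)
open import Data.Integer using (ℤ; +_; -_; _+_; _⊓_) renaming (_≟_ to _≟ℤ_)
open import Relation.Nullary.Decidable using (⌊_⌋)

-- A permutation of {1,…,n} is represented (after shifting values down by 1)
-- as a word π₁⋯πₙ of length n over Fin n with pairwise distinct letters.

words : (k m : ℕ) → List (List (Fin k))
words k zero    = [] ∷ []
words k (suc m) = concatMap (λ x → map (x ∷_) (words k m)) (allFin k)

distinct : {k : ℕ} → List (Fin k) → Bool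
distinct []      = true
distinct (x ∷ w) = not (any (λ y → ⌊ x ≟ y ⌋) w) ∧ distinct w

perms : (n : ℕ) → List (List (Fin n))
perms n = filterᵇ distinct (words n n)

qs : {k : ℕ} → List (Fin k) → List ℤ
qs []           = []
qs (x ∷ [])     = []
qs (x ∷ y ∷ w)  = (if toℕ x <ᵇ toℕ y then + 1 else - (+ 1)) ∷ qs (y ∷ w)

des : {k : ℕ} → List (Fin k) → ℕ
des w = length (filterᵇ (λ q → ⌊ q ≟ℤ - (+ 1) ⌋) (qs w))

-- T(π) = min_{0≤k≤n-1} T_k(π); scanl gives T_0 = 0, T_1, …, T_{n-1}
Tmin : {k : ℕ} → List (Fin k) → ℤ
Tmin w = foldr _⊓_ (+ 0) (scanl _+_ (+ 0) (qs w))

s : ℕ → ℤ → ℤ → ℕ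
s n d t = length (filterᵇ (λ π → ⌊ (+ des π) ≟ℤ d ⌋ ∧ ⌊ Tmin π ≟ℤ t ⌋) (perms n))

-- Reversal π ↦ πₙ⋯π₁ is an involution of Sₙ. It reverses and negates the
-- up-down sequence q^π, so ascents and descents trade places,
-- des(rev π) = n − 1 − des π, and the partial sums become
-- T_k(rev π) = T_{n−1−k}(π) − T_{n−1}(π). Taking minima,
-- T(rev π) = T(π) − T_{n−1}(π) = T(π) + 2 des π − n + 1, so reversal maps
-- S(n,d,t) bijectively onto S(n, n−1−d, t+2d−n+1).
module Submission where

open import Defs
open import Data.Bool using (Bool; true; false; T; _∧_; if_then_else_)
open import Data.Bool.ListAction using (any)
open import Data.Fin using (Fin; toℕ)
open import Data.Fin.Properties using (_≟_; toℕ-injective)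
open import Data.Integer using (ℤ; +_; -_; _+_; _-_; _⊓_) renaming (_≤_ to _≤ℤ_; _≟_ to _≟ℤ_; _*_ to _*ℤ_)
open import Data.Integer.Properties using (neg-injective; neg-distrib-+; ≤-refl; i⊓j≤i; i≥j⇒i⊓j≡j; mono-≤-distrib-⊓; +-monoʳ-≤; +-monoˡ-≤; ⊓-comm; ⊓-assoc; +-assoc; +-comm; +-identityʳ; +-identityˡ; pos-*)
open import Data.Integer.Tactic.RingSolver using (solve-∀)
open import Data.List using (List; []; _∷_; _++_; _∷ʳ_; [_]; foldr; scanl; map; filterᵇ; length; reverse; allFin; concatMap; cartesianProductWith)
open import Data.List.Properties using (∷-injective; unfold-reverse; map-++; length-reverse; reverse-involutive)
open import Data.List.Membership.Propositional using (_∈_; _∉_)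
open import Data.List.Membership.Propositional.Properties using (∈-map⁺; ∈-map⁻; ∈-filter⁺; ∈-filter⁻; ∈-allFin; ∈-cartesianProductWith⁺; ∈-cartesianProductWith⁻)
open import Data.List.Membership.Propositional.Properties.WithK using (unique∧set⇒bag)
open import Data.List.Relation.Binary.BagAndSetEquality using (∼bag⇒↭)
open import Data.List.Relation.Binary.Permutation.Propositional using (_↭_; ↭-sym; ↭⇒↭ₛ)
open import Data.List.Relation.Binary.Permutation.Propositional.Properties using (filter-↭; ↭-length; ↭-reverse)
import Data.List.Relation.Binary.Permutation.Setoid.Properties as PermutationSetoid
open import Data.List.Relation.Unary.All using ([]; _∷_)
open import Data.List.Relation.Unary.All.Properties using (¬Any⇒All¬; All¬⇒¬Any)
open import Data.List.Relation.Unary.Any as Any using (here; there)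
open import Data.List.Relation.Unary.Any.Properties using (any⁺; any⁻)
open import Data.List.Relation.Unary.Unique.Propositional using (Unique; []; _∷_)
open import Data.List.Relation.Unary.Unique.Propositional.Properties using (map⁺; filter⁺; allFin⁺; cartesianProductWith⁺)
open import Data.Nat using (ℕ; zero; suc; _≤_; _*_; z≤n; s≤s; _<ᵇ_)
import Data.Nat as ℕ
open import Data.Nat.Properties using (<-cmp; <⇒<ᵇ; <ᵇ⇒<; +-suc; ≤-trans; m≤m+n)
open import Data.Product using (_×_; _,_; proj₁; proj₂)
open import Function using (_∘_; mk⇔; Injective)
open import Function.Consequences.Propositional using (inverseʳ⇒injective; strictlyInverseʳ⇒inverseʳ)
open import Relation.Binary.Definitions using (DecidableEquality; tri<; tri≈; tri>)
open import Relation.Binary.PropositionalEquality hiding ([_])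
open import Relation.Nullary.Decidable using (⌊_⌋; T?; yes; no; fromWitness; toWitness; dec-true; dec-false)
open import Relation.Nullary.Negation using (contradiction)

module _ {a} {A : Set a} where

  filterᵇ-cong-∈ : ∀ {p q : A → Bool} xs → (∀ {x} → x ∈ xs → p x ≡ q x) →
                   filterᵇ p xs ≡ filterᵇ q xs
  filterᵇ-cong-∈ [] p≡q = refl
  filterᵇ-cong-∈ {p} {q} (x ∷ xs) p≡q rewrite p≡q (here refl) with q x
  ... | true  = cong (x ∷_) (filterᵇ-cong-∈ xs (p≡q ∘ there))
  ... | false = filterᵇ-cong-∈ xs (p≡q ∘ there)

  length-filterᵇ-map : ∀ {b} {B : Set b} (f : B → A) p xs →
                       length (filterᵇ p (map f xs)) ≡ length (filterᵇ (p ∘ f) xs)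
  length-filterᵇ-map f p [] = refl
  length-filterᵇ-map f p (x ∷ xs) with p (f x)
  ... | true  = cong suc (length-filterᵇ-map f p xs)
  ... | false = length-filterᵇ-map f p xs

  length-filterᵇ-↭ : ∀ p {xs ys : List A} → xs ↭ ys → length (filterᵇ p xs) ≡ length (filterᵇ p ys)
  length-filterᵇ-↭ p xs↭ys = ↭-length (filter-↭ (T? ∘ p) xs↭ys)

  length-filterᵇ-reindex : ∀ (f : A → A) {p q : A → Bool} {xs} → xs ↭ map f xs →
                           (∀ {x} → x ∈ xs → p x ≡ q (f x)) →
                           length (filterᵇ p xs) ≡ length (filterᵇ q xs)
  length-filterᵇ-reindex f {p} {q} {xs} xs↭fxs p≡q∘f = begin
    length (filterᵇ p xs)         ≡⟨ cong length (filterᵇ-cong-∈ xs p≡q∘f) ⟩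
    length (filterᵇ (q ∘ f) xs)   ≡⟨ length-filterᵇ-map f q xs ⟨
    length (filterᵇ q (map f xs)) ≡⟨ length-filterᵇ-↭ q xs↭fxs ⟨
    length (filterᵇ q xs)         ∎
    where open ≡-Reasoning

  ↭-map-involution : ∀ (f : A → A) {xs} → (∀ x → f (f x) ≡ x) → Unique xs →
                     (∀ {x} → x ∈ xs → f x ∈ xs) → xs ↭ map f xs
  ↭-map-involution f {xs} ff≡id xs! f-closed =
    ∼bag⇒↭ (unique∧set⇒bag xs! (map⁺ f-injective xs!) (mk⇔ ∈⇒∈-map ∈-map⇒∈))
    where
    f-injective : Injective _≡_ _≡_ f
    f-injective = inverseʳ⇒injective f (strictlyInverseʳ⇒inverseʳ {f⁻¹ = f} f ff≡id)
    ∈⇒∈-map : ∀ {x} → x ∈ xs → x ∈ map f xs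
    ∈⇒∈-map {x} x∈xs = subst (_∈ map f xs) (ff≡id x) (∈-map⁺ f (f-closed x∈xs))
    ∈-map⇒∈ : ∀ {x} → x ∈ map f xs → x ∈ xs
    ∈-map⇒∈ x∈fxs with ∈-map⁻ f x∈fxs
    ... | y , y∈xs , refl = f-closed y∈xs

⌊≟⌋-injective : ∀ {a b} {A : Set a} {B : Set b} (_≟A_ : DecidableEquality A) (_≟B_ : DecidableEquality B)
                {f : A → B} → Injective _≡_ _≡_ f → ∀ x y → ⌊ f x ≟B f y ⌋ ≡ ⌊ x ≟A y ⌋
⌊≟⌋-injective _≟A_ _≟B_ {f} f-inj x y with x ≟A y | f x ≟B f y
... | yes refl | yes _     = refl
... | yes refl | no fx≢fx  = contradiction refl fx≢fx
... | no _     | no _      = refl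
... | no x≢y   | yes fx≡fy = contradiction (f-inj fx≡fy) x≢y

⌊≟⌋-∧-⌊≟⌋-injective : ∀ {a b} {A : Set a} {B : Set b} (_≟A_ : DecidableEquality A) (_≟B_ : DecidableEquality B)
                      {f : A → A} {g : A → B → B} →
                      Injective _≡_ _≡_ f → (∀ x → Injective _≡_ _≡_ (g x)) → ∀ x x′ y y′ →
                      (⌊ f x ≟A f x′ ⌋ ∧ ⌊ g x y ≟B g x′ y′ ⌋) ≡ (⌊ x ≟A x′ ⌋ ∧ ⌊ y ≟B y′ ⌋)
⌊≟⌋-∧-⌊≟⌋-injective _≟A_ _≟B_ f-inj g-inj x x′ y y′
  rewrite ⌊≟⌋-injective _≟A_ _≟A_ f-inj x x′ with x ≟A x′
... | yes refl = ⌊≟⌋-injective _≟B_ _≟B_ (g-inj x) y y′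
... | no _     = refl

concatMap-map≡cartesianProductWith : ∀ {a b c} {A : Set a} {B : Set b} {C : Set c}
  (f : A → B → C) xs ys → concatMap (λ x → map (f x) ys) xs ≡ cartesianProductWith f xs ys
concatMap-map≡cartesianProductWith f []       ys = refl
concatMap-map≡cartesianProductWith f (x ∷ xs) ys =
  cong (map (f x) ys ++_) (concatMap-map≡cartesianProductWith f xs ys)

module _ {k : ℕ} where

  words-suc : ∀ m → words k (suc m) ≡ cartesianProductWith _∷_ (allFin k) (words k m)
  words-suc m = concatMap-map≡cartesianProductWith _∷_ (allFin k) (words k m)

  ∈-words : (w : List (Fin k)) → w ∈ words k (length w)
  ∈-words []      = here refl
  ∈-words (x ∷ w) = subst (x ∷ w ∈_) (sym (words-suc (length w)))
                          (∈-cartesianProductWith⁺ _∷_ (∈-allFin x) (∈-words w))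

  length-∈-words : ∀ m {w : List (Fin k)} → w ∈ words k m → length w ≡ m
  length-∈-words zero    (here refl) = refl
  length-∈-words (suc m) w∈ with ∈-cartesianProductWith⁻ _∷_ (allFin k) (words k m)
                                    (subst (_ ∈_) (words-suc m) w∈)
  ... | _ , v , _ , v∈ , refl = cong suc (length-∈-words m v∈)

  Unique-words : ∀ m → Unique (words k m)
  Unique-words zero    = [] ∷ []
  Unique-words (suc m) = subst Unique (sym (words-suc m))
    (cartesianProductWith⁺ _∷_ ∷-injective (allFin⁺ k) (Unique-words m))

  distinct⇒Unique : (w : List (Fin k)) → T (distinct w) → Unique w
  distinct⇒Unique []      _ = []
  distinct⇒Unique (x ∷ w) h with any (λ y → ⌊ x ≟ y ⌋) w in x∈w?
  ... | false = ¬Any⇒All¬ w x∉w ∷ distinct⇒Unique w h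
    where
    x∉w : x ∉ w
    x∉w x∈w = subst T x∈w? (any⁺ _ (Any.map fromWitness x∈w))

  Unique⇒distinct : (w : List (Fin k)) → Unique w → T (distinct w)
  Unique⇒distinct []      _ = _
  Unique⇒distinct (x ∷ w) (x∉w ∷ w!) with any (λ y → ⌊ x ≟ y ⌋) w in x∈w?
  ... | true  = All¬⇒¬Any x∉w (Any.map toWitness (any⁻ _ w (subst T (sym x∈w?) _)))
  ... | false = Unique⇒distinct w w!

module _ {n : ℕ} where

  ∈-perms⁺ : ∀ {w : List (Fin n)} → length w ≡ n → Unique w → w ∈ perms n
  ∈-perms⁺ {w} |w|≡n w! =
    ∈-filter⁺ (T? ∘ distinct) (subst (λ m → w ∈ words n m) |w|≡n (∈-words w)) (Unique⇒distinct w w!)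

  ∈-perms⁻ : ∀ {w : List (Fin n)} → w ∈ perms n → length w ≡ n × Unique w
  ∈-perms⁻ {w} w∈ with ∈-filter⁻ (T? ∘ distinct) {xs = words n n} w∈
  ... | w∈words , dw = length-∈-words n w∈words , distinct⇒Unique w dw

  Unique-perms : Unique (perms n)
  Unique-perms = filter⁺ (T? ∘ distinct) (Unique-words n)

  reverse-∈-perms : ∀ {w : List (Fin n)} → w ∈ perms n → reverse w ∈ perms n
  reverse-∈-perms {w} w∈ with ∈-perms⁻ w∈
  ... | |w|≡n , w! = ∈-perms⁺ (trans (length-reverse w) |w|≡n)
    (PermutationSetoid.Unique-resp-↭ (setoid (Fin n)) (↭⇒↭ₛ (↭-sym (↭-reverse w))) w!)

  perms-↭-map-reverse : perms n ↭ map reverse (perms n)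
  perms-↭-map-reverse = ↭-map-involution reverse reverse-involutive Unique-perms reverse-∈-perms

module _ {k : ℕ} where

  updown : Fin k → Fin k → ℤ
  updown x y = if toℕ x <ᵇ toℕ y then + 1 else - (+ 1)

  updown-flip : ∀ {x y} → x ≢ y → updown y x ≡ - updown x y
  updown-flip {x} {y} x≢y with <-cmp (toℕ x) (toℕ y)
  ... | tri< x<y _ y≮x rewrite dec-true (T? (toℕ x <ᵇ toℕ y)) (<⇒<ᵇ x<y)
                             | dec-false (T? (toℕ y <ᵇ toℕ x)) (y≮x ∘ <ᵇ⇒< _ _) = refl
  ... | tri≈ _ x≡y _   = contradiction (toℕ-injective x≡y) x≢y
  ... | tri> x≮y _ y<x rewrite dec-false (T? (toℕ x <ᵇ toℕ y)) (x≮y ∘ <ᵇ⇒< _ _)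
                             | dec-true (T? (toℕ y <ᵇ toℕ x)) (<⇒<ᵇ y<x) = refl

  qs-∷ʳ : ∀ (u : List (Fin k)) y x → qs (u ∷ʳ y ∷ʳ x) ≡ qs (u ∷ʳ y) ∷ʳ updown y x
  qs-∷ʳ []          y x = refl
  qs-∷ʳ (a ∷ [])    y x = refl
  qs-∷ʳ (a ∷ b ∷ u) y x = cong (updown a b ∷_) (qs-∷ʳ (b ∷ u) y x)

  qs-reverse : ∀ (w : List (Fin k)) → Unique w → qs (reverse w) ≡ map (-_) (reverse (qs w))
  qs-reverse []          _ = refl
  qs-reverse (x ∷ [])    _ = refl
  qs-reverse (x ∷ y ∷ w) ((x≢y ∷ _) ∷ yw!) = begin
    qs (reverse (x ∷ y ∷ w))                        ≡⟨ cong qs reverse-xyw ⟩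
    qs (reverse w ∷ʳ y ∷ʳ x)                        ≡⟨ qs-∷ʳ (reverse w) y x ⟩
    qs (reverse w ∷ʳ y) ∷ʳ updown y x               ≡⟨ cong (λ v → qs v ∷ʳ updown y x) (unfold-reverse y w) ⟨
    qs (reverse (y ∷ w)) ∷ʳ updown y x              ≡⟨ cong₂ _∷ʳ_ (qs-reverse (y ∷ w) yw!) (updown-flip x≢y) ⟩
    map (-_) (reverse (qs (y ∷ w))) ∷ʳ - updown x y ≡⟨ map-++ (-_) (reverse (qs (y ∷ w))) [ updown x y ] ⟨
    map (-_) (reverse (qs (y ∷ w)) ∷ʳ updown x y)   ≡⟨ cong (map (-_)) (unfold-reverse (updown x y) (qs (y ∷ w))) ⟨
    map (-_) (reverse (qs (x ∷ y ∷ w)))             ∎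
    where
    open ≡-Reasoning
    reverse-xyw : reverse (x ∷ y ∷ w) ≡ reverse w ∷ʳ y ∷ʳ x
    reverse-xyw = trans (unfold-reverse x (y ∷ w)) (cong (_∷ʳ x) (unfold-reverse y w))

  length≡suc-length-qs : ∀ (w : List (Fin k)) → 1 ≤ length w → length w ≡ suc (length (qs w))
  length≡suc-length-qs (x ∷ [])    _ = refl
  length≡suc-length-qs (x ∷ y ∷ w) _ = cong suc (length≡suc-length-qs (y ∷ w) (s≤s z≤n))

isDescent isAscent : ℤ → Bool
isDescent q = ⌊ q ≟ℤ - (+ 1) ⌋
isAscent q = ⌊ q ≟ℤ + 1 ⌋

ascents : ∀ {k} → List (Fin k) → ℕ
ascents w = length (filterᵇ isAscent (qs w))

sumℤ : List ℤ → ℤ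
sumℤ = foldr _+_ (+ 0)

module _ {k : ℕ} where

  des-reverse : ∀ (w : List (Fin k)) → Unique w → des (reverse w) ≡ ascents w
  des-reverse w w! = begin
    length (filterᵇ isDescent (qs (reverse w)))            ≡⟨ cong (length ∘ filterᵇ isDescent) (qs-reverse w w!) ⟩
    length (filterᵇ isDescent (map (-_) (reverse (qs w)))) ≡⟨ length-filterᵇ-map (-_) isDescent (reverse (qs w)) ⟩
    length (filterᵇ (isDescent ∘ (-_)) (reverse (qs w)))   ≡⟨ length-filterᵇ-↭ (isDescent ∘ (-_)) (↭-reverse (qs w)) ⟩
    length (filterᵇ (isDescent ∘ (-_)) (qs w))             ≡⟨ cong length (filterᵇ-cong-∈ (qs w) (λ {q} _ → neg-test q)) ⟩
    ascents w                                              ∎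
    where
    open ≡-Reasoning
    neg-test : ∀ q → isDescent (- q) ≡ isAscent q
    neg-test q = ⌊≟⌋-injective _≟ℤ_ _≟ℤ_ neg-injective q (+ 1)

  ascents+des≡length-qs : ∀ (w : List (Fin k)) → ascents w ℕ.+ des w ≡ length (qs w)
  ascents+des≡length-qs []          = refl
  ascents+des≡length-qs (x ∷ [])    = refl
  ascents+des≡length-qs (x ∷ y ∷ w) with toℕ x <ᵇ toℕ y | ascents+des≡length-qs (y ∷ w)
  ... | true  | ih = cong suc ih
  ... | false | ih = trans (+-suc (ascents (y ∷ w)) (des (y ∷ w))) (cong suc ih)

  sum-qs≡ascents-des : ∀ (w : List (Fin k)) → sumℤ (qs w) ≡ + ascents w - + des w
  sum-qs≡ascents-des []          = refl
  sum-qs≡ascents-des (x ∷ [])    = refl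
  sum-qs≡ascents-des (x ∷ y ∷ w) with toℕ x <ᵇ toℕ y | sum-qs≡ascents-des (y ∷ w)
  ... | true  | ih = trans (cong (λ z → + 1 + z) ih) (ascent-step (+ ascents (y ∷ w)) (+ des (y ∷ w)))
    where
    ascent-step : ∀ a d → + 1 + (a - d) ≡ (+ 1 + a) - d
    ascent-step = solve-∀
  ... | false | ih = trans (cong (λ z → - (+ 1) + z) ih) (descent-step (+ ascents (y ∷ w)) (+ des (y ∷ w)))
    where
    descent-step : ∀ a d → - (+ 1) + (a - d) ≡ a - (+ 1 + d)
    descent-step = solve-∀

minPrefixSum : List ℤ → ℤ
minPrefixSum []      = + 0
minPrefixSum (q ∷ L) = + 0 ⊓ (q + minPrefixSum L)

minPrefixSum≤0 : ∀ L → minPrefixSum L ≤ℤ + 0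
minPrefixSum≤0 []      = ≤-refl
minPrefixSum≤0 (q ∷ L) = i⊓j≤i (+ 0) _

+-distribˡ-⊓ : ∀ c x y → c + (x ⊓ y) ≡ (c + x) ⊓ (c + y)
+-distribˡ-⊓ c = mono-≤-distrib-⊓ (+-monoʳ-≤ c)

+-distribʳ-⊓ : ∀ c x y → (x ⊓ y) + c ≡ (x + c) ⊓ (y + c)
+-distribʳ-⊓ c = mono-≤-distrib-⊓ (+-monoˡ-≤ c)

foldr-⊓-scanl-+ : ∀ c L → foldr _⊓_ (+ 0) (scanl _+_ c L) ≡ + 0 ⊓ (c + minPrefixSum L)
foldr-⊓-scanl-+ c []      = trans (⊓-comm c (+ 0)) (cong (+ 0 ⊓_) (sym (+-identityʳ c)))
foldr-⊓-scanl-+ c (q ∷ L) = begin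
  c ⊓ foldr _⊓_ (+ 0) (scanl _+_ (c + q) L)      ≡⟨ cong (c ⊓_) (foldr-⊓-scanl-+ (c + q) L) ⟩
  c ⊓ (+ 0 ⊓ ((c + q) + minPrefixSum L))         ≡⟨ ⊓-assoc c (+ 0) _ ⟨
  (c ⊓ + 0) ⊓ ((c + q) + minPrefixSum L)         ≡⟨ cong₂ _⊓_ (⊓-comm c (+ 0)) (+-assoc c q _) ⟩
  (+ 0 ⊓ c) ⊓ (c + (q + minPrefixSum L))         ≡⟨ ⊓-assoc (+ 0) c _ ⟩
  + 0 ⊓ (c ⊓ (c + (q + minPrefixSum L)))         ≡⟨ cong (λ z → + 0 ⊓ (z ⊓ (c + (q + minPrefixSum L)))) (+-identityʳ c) ⟨
  + 0 ⊓ ((c + + 0) ⊓ (c + (q + minPrefixSum L))) ≡⟨ cong (+ 0 ⊓_) (+-distribˡ-⊓ c (+ 0) _) ⟨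
  + 0 ⊓ (c + minPrefixSum (q ∷ L))               ∎
  where open ≡-Reasoning

Tmin≡minPrefixSum : ∀ {k} (w : List (Fin k)) → Tmin w ≡ minPrefixSum (qs w)
Tmin≡minPrefixSum w = begin
  foldr _⊓_ (+ 0) (scanl _+_ (+ 0) (qs w)) ≡⟨ foldr-⊓-scanl-+ (+ 0) (qs w) ⟩
  + 0 ⊓ (+ 0 + minPrefixSum (qs w))        ≡⟨ cong (+ 0 ⊓_) (+-identityˡ _) ⟩
  + 0 ⊓ minPrefixSum (qs w)                ≡⟨ i≥j⇒i⊓j≡j (minPrefixSum≤0 (qs w)) ⟩
  minPrefixSum (qs w)                      ∎
  where open ≡-Reasoning

minPrefixSum-∷ʳ : ∀ L q → minPrefixSum (L ∷ʳ q) ≡ minPrefixSum L ⊓ (sumℤ L + q)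
minPrefixSum-∷ʳ []      q = cong (+ 0 ⊓_) (trans (+-identityʳ q) (sym (+-identityˡ q)))
minPrefixSum-∷ʳ (p ∷ L) q = begin
  + 0 ⊓ (p + minPrefixSum (L ∷ʳ q))                 ≡⟨ cong (λ z → + 0 ⊓ (p + z)) (minPrefixSum-∷ʳ L q) ⟩
  + 0 ⊓ (p + (minPrefixSum L ⊓ (sumℤ L + q)))       ≡⟨ cong (+ 0 ⊓_) (+-distribˡ-⊓ p _ _) ⟩
  + 0 ⊓ ((p + minPrefixSum L) ⊓ (p + (sumℤ L + q))) ≡⟨ ⊓-assoc (+ 0) _ _ ⟨
  (+ 0 ⊓ (p + minPrefixSum L)) ⊓ (p + (sumℤ L + q)) ≡⟨ cong (minPrefixSum (p ∷ L) ⊓_) (+-assoc p _ q) ⟨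
  minPrefixSum (p ∷ L) ⊓ ((p + sumℤ L) + q)         ∎
  where open ≡-Reasoning

sumℤ-∷ʳ : ∀ L q → sumℤ (L ∷ʳ q) ≡ sumℤ L + q
sumℤ-∷ʳ []      q = trans (+-identityʳ q) (sym (+-identityˡ q))
sumℤ-∷ʳ (p ∷ L) q = trans (cong (λ z → p + z) (sumℤ-∷ʳ L q)) (sym (+-assoc p _ q))

sumℤ-neg-reverse : ∀ L → sumℤ (map (-_) (reverse L)) ≡ - sumℤ L
sumℤ-neg-reverse []      = refl
sumℤ-neg-reverse (q ∷ L) = begin
  sumℤ (map (-_) (reverse (q ∷ L)))  ≡⟨ cong (sumℤ ∘ map (-_)) (unfold-reverse q L) ⟩
  sumℤ (map (-_) (reverse L ∷ʳ q))   ≡⟨ cong sumℤ (map-++ (-_) (reverse L) [ q ]) ⟩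
  sumℤ (map (-_) (reverse L) ∷ʳ - q) ≡⟨ sumℤ-∷ʳ (map (-_) (reverse L)) (- q) ⟩
  sumℤ (map (-_) (reverse L)) + - q  ≡⟨ cong (λ z → z + - q) (sumℤ-neg-reverse L) ⟩
  - sumℤ L + - q                     ≡⟨ trans (neg-distrib-+ q (sumℤ L)) (+-comm (- q) _) ⟨
  - sumℤ (q ∷ L)                     ∎
  where open ≡-Reasoning

minPrefixSum-neg-reverse : ∀ L → minPrefixSum (map (-_) (reverse L)) ≡ minPrefixSum L - sumℤ L
minPrefixSum-neg-reverse []      = refl
minPrefixSum-neg-reverse (q ∷ L) = begin
  minPrefixSum (map (-_) (reverse (q ∷ L)))
    ≡⟨ cong (minPrefixSum ∘ map (-_)) (unfold-reverse q L) ⟩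
  minPrefixSum (map (-_) (reverse L ∷ʳ q))
    ≡⟨ cong minPrefixSum (map-++ (-_) (reverse L) [ q ]) ⟩
  minPrefixSum (map (-_) (reverse L) ∷ʳ - q)
    ≡⟨ minPrefixSum-∷ʳ (map (-_) (reverse L)) (- q) ⟩
  minPrefixSum (map (-_) (reverse L)) ⊓ (sumℤ (map (-_) (reverse L)) + - q)
    ≡⟨ cong₂ (λ m S → m ⊓ (S - q)) (minPrefixSum-neg-reverse L) (sumℤ-neg-reverse L) ⟩
  (minPrefixSum L - sumℤ L) ⊓ (- sumℤ L - q)
    ≡⟨ ⊓-comm _ _ ⟩
  (- sumℤ L - q) ⊓ (minPrefixSum L - sumℤ L)
    ≡⟨ cong₂ _⊓_ (shift-zero q (sumℤ L)) (shift-step q (minPrefixSum L) (sumℤ L)) ⟨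
  (+ 0 - sumℤ (q ∷ L)) ⊓ ((q + minPrefixSum L) - sumℤ (q ∷ L))
    ≡⟨ +-distribʳ-⊓ (- sumℤ (q ∷ L)) (+ 0) (q + minPrefixSum L) ⟨
  minPrefixSum (q ∷ L) - sumℤ (q ∷ L)
    ∎
  where
  open ≡-Reasoning
  shift-zero : ∀ q S → + 0 - (q + S) ≡ - S - q
  shift-zero = solve-∀
  shift-step : ∀ q m S → (q + m) - (q + S) ≡ m - S
  shift-step = solve-∀

reflectDes : ℕ → ℤ → ℤ
reflectDes n d = + n - + 1 - d

shiftTmin : ℕ → ℤ → ℤ → ℤ
shiftTmin n d t = t + (+ 2) *ℤ d - + n + + 1

reflectDes-injective : ∀ n → Injective _≡_ _≡_ (reflectDes n)
reflectDes-injective n = inverseʳ⇒injective (reflectDes n)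
  (strictlyInverseʳ⇒inverseʳ {f⁻¹ = reflectDes n} (reflectDes n) (λ d → reflectDes-involutive (+ n) d))
  where
  reflectDes-involutive : ∀ m d → m - + 1 - (m - + 1 - d) ≡ d
  reflectDes-involutive = solve-∀

shiftTmin-injective : ∀ n d → Injective _≡_ _≡_ (shiftTmin n d)
shiftTmin-injective n d = inverseʳ⇒injective (shiftTmin n d)
  (strictlyInverseʳ⇒inverseʳ {f⁻¹ = λ t′ → t′ - (+ 2) *ℤ d + + n - + 1} (shiftTmin n d) (λ t → unshift (+ n) d t))
  where
  unshift : ∀ m d t → (t + (+ 2) *ℤ d - m + + 1) - (+ 2) *ℤ d + m - + 1 ≡ t
  unshift = solve-∀

hasStatistics : ∀ {n} → ℤ → ℤ → List (Fin n) → Bool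
hasStatistics d t π = ⌊ + des π ≟ℤ d ⌋ ∧ ⌊ Tmin π ≟ℤ t ⌋

module _ {n : ℕ} {π : List (Fin n)} (π∈perms : π ∈ perms n) (1≤n : 1 ≤ n) where

  private
    |π|≡n : length π ≡ n
    |π|≡n = proj₁ (∈-perms⁻ π∈perms)

    π! : Unique π
    π! = proj₂ (∈-perms⁻ π∈perms)

  n≡suc[ascents+des] : n ≡ suc (ascents π ℕ.+ des π)
  n≡suc[ascents+des] = begin
    n                         ≡⟨ |π|≡n ⟨
    length π                  ≡⟨ length≡suc-length-qs π (subst (1 ≤_) (sym |π|≡n) 1≤n) ⟩
    suc (length (qs π))       ≡⟨ cong suc (ascents+des≡length-qs π) ⟨
    suc (ascents π ℕ.+ des π) ∎
    where open ≡-Reasoning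

  des-reverse-perm : + des (reverse π) ≡ reflectDes n (+ des π)
  des-reverse-perm = begin
    + des (reverse π)                                ≡⟨ cong +_ (des-reverse π π!) ⟩
    + ascents π                                      ≡⟨ reflect-step (+ ascents π) (+ des π) ⟩
    reflectDes (suc (ascents π ℕ.+ des π)) (+ des π) ≡⟨ cong (λ m → reflectDes m (+ des π)) n≡suc[ascents+des] ⟨
    reflectDes n (+ des π)                           ∎
    where
    open ≡-Reasoning
    reflect-step : ∀ a d → a ≡ (+ 1 + (a + d)) - + 1 - d
    reflect-step = solve-∀

  Tmin-reverse-perm : Tmin (reverse π) ≡ shiftTmin n (+ des π) (Tmin π)
  Tmin-reverse-perm = begin
    Tmin (reverse π)
      ≡⟨ Tmin≡minPrefixSum (reverse π) ⟩
    minPrefixSum (qs (reverse π))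
      ≡⟨ cong minPrefixSum (qs-reverse π π!) ⟩
    minPrefixSum (map (-_) (reverse (qs π)))
      ≡⟨ minPrefixSum-neg-reverse (qs π) ⟩
    minPrefixSum (qs π) - sumℤ (qs π)
      ≡⟨ cong₂ _-_ (sym (Tmin≡minPrefixSum π)) (sum-qs≡ascents-des π) ⟩
    Tmin π - (+ ascents π - + des π)
      ≡⟨ shift-step (Tmin π) (+ ascents π) (+ des π) ⟩
    shiftTmin (suc (ascents π ℕ.+ des π)) (+ des π) (Tmin π)
      ≡⟨ cong (λ m → shiftTmin m (+ des π) (Tmin π)) n≡suc[ascents+des] ⟨
    shiftTmin n (+ des π) (Tmin π)
      ∎
    where
    open ≡-Reasoning
    shift-step : ∀ T a d → T - (a - d) ≡ T + (+ 2) *ℤ d - (+ 1 + (a + d)) + + 1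
    shift-step = solve-∀

  hasStatistics-reverse : ∀ d t → hasStatistics d t π ≡ hasStatistics (reflectDes n d) (shiftTmin n d t) (reverse π)
  hasStatistics-reverse d t = begin
    hasStatistics d t π
      ≡⟨ ⌊≟⌋-∧-⌊≟⌋-injective _≟ℤ_ _≟ℤ_ (reflectDes-injective n) (shiftTmin-injective n) (+ des π) d (Tmin π) t ⟨
    ⌊ reflectDes n (+ des π) ≟ℤ reflectDes n d ⌋ ∧ ⌊ shiftTmin n (+ des π) (Tmin π) ≟ℤ shiftTmin n d t ⌋
      ≡⟨ cong₂ (λ δ τ → ⌊ δ ≟ℤ reflectDes n d ⌋ ∧ ⌊ τ ≟ℤ shiftTmin n d t ⌋) des-reverse-perm Tmin-reverse-perm ⟨
    hasStatistics (reflectDes n d) (shiftTmin n d t) (reverse π)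
      ∎
    where open ≡-Reasoning

s-reverse-symmetry : ∀ n d t → 1 ≤ n → s n d t ≡ s n (reflectDes n d) (shiftTmin n d t)
s-reverse-symmetry n d t 1≤n =
  length-filterᵇ-reindex reverse perms-↭-map-reverse (λ π∈ → hasStatistics-reverse π∈ 1≤n d t)

corollary5p4 : ((n : ℕ) (d t : ℤ) → 1 ≤ n →
                 s n d t ≡ s n ((+ n) - + 1 - d) (t + (+ 2) *ℤ d - + n + + 1))
               × ((n : ℕ) → 1 ≤ n →
                 s (2 * n) ((+ n) - + 1) (+ 0) ≡ s (2 * n) (+ n) (- (+ 1)))
corollary5p4 = s-reverse-symmetry , λ n 1≤n → begin
  s (2 * n) (+ n - + 1) (+ 0)
    ≡⟨ s-reverse-symmetry (2 * n) (+ n - + 1) (+ 0) (≤-trans 1≤n (m≤m+n n _)) ⟩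
  s (2 * n) (reflectDes (2 * n) (+ n - + 1)) (shiftTmin (2 * n) (+ n - + 1) (+ 0))
    ≡⟨ cong (λ N → s (2 * n) (N - + 1 - (+ n - + 1)) (+ 0 + (+ 2) *ℤ (+ n - + 1) - N + + 1)) (pos-* 2 n) ⟩
  s (2 * n) ((+ 2) *ℤ + n - + 1 - (+ n - + 1)) (+ 0 + (+ 2) *ℤ (+ n - + 1) - (+ 2) *ℤ + n + + 1)
    ≡⟨ cong₂ (s (2 * n)) (reflected (+ n)) (shifted (+ n)) ⟩
  s (2 * n) (+ n) (- (+ 1))
    ∎
  where
  open ≡-Reasoning
  reflected : ∀ m → (+ 2) *ℤ m - + 1 - (m - + 1) ≡ m
  reflected = solve-∀
  shifted : ∀ m → + 0 + (+ 2) *ℤ (m - + 1) - (+ 2) *ℤ m + + 1 ≡ - (+ 1)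
  shifted = solve-∀
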